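{- Let $G=(V,E)$ be a finite simple undirected graph with $m=|E|\ge 1$ edges, and let $q\in[0,\tfrac12]$. Sample one edge uniformly at random from $E$, let $p=1/m$, and for each $e\in E$ let $X_e$ be the $0$--$1$ random variable indicating whether $e$ is the sampled edge. For $v\in V$ define $$X_q(v)=\sum_{e\in E:\, v\in e}\frac{q\,|\Delta_e|\,X_e}{p}+(1-2q)\sum_{e\in E:\, v\in \mathcal{N}_e}\frac{X_e}{p}.$$ Then for every $v\in V$, $\mathbb{E}[X_q(v)]=|\Delta_v|$, where the expectation is over the random edge.
   Context: For $v\in V$, $\mathcal{N}_v$ denotes the set of neighbors of $v$. For an edge $e=\{u,v\}$, $\mathcal{N}_e=\mathcal{N}_u\cap\mathcal{N}_v$ is the set of nodes adjacent to both endpoints of $e$. A triangle is a set of three edges $\{\{u,v\},\{v,w\},\{w,u\}\}\subseteq E$ on three distinct nodes. $\Delta_v$ is the set of triangles containing node $v$, and $\Delta_e$ is the set of triangles containing edge $e$.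
   Formalization: The parameter q takes only rational values in [0, ½]. -}

module Defs where

open import Data.Nat as ℕ using (ℕ; zero; suc; _<ᵇ_)
open import Data.Fin using (Fin; toℕ; _≟_)
open import Data.Bool using (Bool; true; false; _∧_; _∨_; if_then_else_)
open import Data.List using (List; []; _∷_; concatMap; length; filterᵇ; foldr; map)
open import Data.List.Base using (allFin)
open import Data.Product using (_×_; _,_)
open import Data.Integer using (+_)
open import Data.Rational using (ℚ; _/_; _+_; _*_; _-_; _÷_; 0ℚ; 1ℚ; NonZero)
open import Data.Rational.Properties using (normalize-pos; pos⇒nonZero)
open import Relation.Nullary.Decidable using (⌊_⌋)
open import Relation.Binary.PropositionalEquality using (_≡_)

record Graph (n : ℕ) : Set where
  field
    adj    : Fin n → Fin n → Bool
    adj-sym : ∀ i j → adj i j ≡ adj j i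
    adj-irr : ∀ i → adj i i ≡ false
open Graph public

ℕ→ℚ : ℕ → ℚ
ℕ→ℚ k = (+ k) / 1

𝟙 : Bool → ℚ
𝟙 b = if b then 1ℚ else 0ℚ

Σℚ : List ℚ → ℚ
Σℚ = foldr _+_ 0ℚ

_=ᵇ_ : ∀ {n} → Fin n → Fin n → Bool
i =ᵇ j = ⌊ i ≟ j ⌋

_<ᶠ_ : ∀ {n} → Fin n → Fin n → Bool
i <ᶠ j = toℕ i <ᵇ toℕ j

module _ {n : ℕ} (G : Graph n) where

  -- an edge {u,v} is represented as the pair (u , v) with u < v
  Edge : Set
  Edge = Fin n × Fin n

  E : List Edge
  E = concatMap (λ u → concatMap (λ v →
        if (u <ᶠ v) ∧ adj G u v then (u , v) ∷ [] else []) (allFin n)) (allFin n)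

  m : ℕ
  m = length E

  -- a triangle {{u,v},{v,w},{w,u}} on distinct nodes, represented by u < v < w
  Triangle : Set
  Triangle = Fin n × Fin n × Fin n

  Triangles : List Triangle
  Triangles = concatMap (λ u → concatMap (λ v → concatMap (λ w →
      if (u <ᶠ v) ∧ (v <ᶠ w) ∧ adj G u v ∧ adj G v w ∧ adj G w u
      then (u , v , w) ∷ [] else []) (allFin n)) (allFin n)) (allFin n)

  _∈ᵗ_ : Fin n → Triangle → Bool
  x ∈ᵗ (u , v , w) = (x =ᵇ u) ∨ (x =ᵇ v) ∨ (x =ᵇ w)

  Δᵥ : Fin n → ℕ
  Δᵥ x = length (filterᵇ (x ∈ᵗ_) Triangles)

  _∈ᵉ_ : Fin n → Edge → Bool
  x ∈ᵉ (u , v) = (x =ᵇ u) ∨ (x =ᵇ v)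

  Δₑ : Edge → ℕ
  Δₑ (u , v) = length (filterᵇ (λ t → (u ∈ᵗ t) ∧ (v ∈ᵗ t)) Triangles)

  -- x ∈ N_e = N_u ∩ N_v
  _∈ᴺ_ : Fin n → Edge → Bool
  x ∈ᴺ (u , v) = adj G u x ∧ adj G v x

  _=ᵉ_ : Edge → Edge → Bool
  (a , b) =ᵉ (c , d) = (a =ᵇ c) ∧ (b =ᵇ d)

  -- Probability space: the sampled edge ω is uniform on E (requires m ≥ 1).
  module Sampling .{{m≥1 : ℕ.NonZero m}} where

    p : ℚ
    p = (+ 1) / m

    instance
      p-nonZero : NonZero p
      p-nonZero = pos⇒nonZero p {{normalize-pos 1 m}}

    X : Edge → Edge → ℚ
    X e ω = 𝟙 (e =ᵉ ω)

    Xq : ℚ → Fin n → Edge → ℚ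
    Xq q v ω =
        Σℚ (map (λ e → ((q * ℕ→ℚ (Δₑ e) * X e ω) ÷ p)) (filterᵇ (v ∈ᵉ_) E))
      + (1ℚ - (ℕ→ℚ 2 * q)) * Σℚ (map (λ e → X e ω ÷ p) (filterᵇ (v ∈ᴺ_) E))

    𝔼 : (Edge → ℚ) → ℚ
    𝔼 Y = Σℚ (map (λ ω → p * Y ω) E)

{-# OPTIONS --safe #-}
module Submission where

open import Defs
open import Data.Nat using (ℕ; NonZero)
open import Data.Fin using (Fin)
open import Data.Rational using (ℚ; _≤_; 0ℚ; ½)
open import Relation.Binary.PropositionalEquality using (_≡_)

import Data.Nat as ℕ
open import Algebra.Bundles using (CommutativeSemiring)
open import Data.Bool using (Bool; true; false; if_then_else_; _∧_; not; T)
open import Data.Bool.Properties using (∧-comm; ∧-assoc; T-∧; T-≡; ∧-commutativeMonoid)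
open import Data.Empty using (⊥-elim)
open import Data.Fin using (zero; suc; _≟_)
open import Data.Fin.Properties using (toℕ-injective)
open import Data.List using (List; []; _∷_; _++_; map; foldr; concatMap; filterᵇ; allFin; tabulate; length)
open import Data.List.Properties using (map-++; map-tabulate)
open import Data.List.Relation.Unary.All as All using (All; []; _∷_; universal)
open import Data.List.Relation.Unary.All.Properties using (concat⁺; map⁺; tabulate⁺; filter⁺)
open import Data.Product using (_×_; _,_; proj₁; proj₂)
open import Function using (_∘_)
open import Function.Bundles using (module Equivalence)
open Equivalence using (to)
import Relation.Binary.PropositionalEquality as ≡
open ≡ using (_≢_)
open import Relation.Nullary using (yes; no; ofʸ; ofⁿ)
open import Relation.Nullary.Decidable using (T?)
open import Relation.Nullary.Negation using (contradiction)

-- Since exactly one edge ω is sampled, an inverse-probability-weighted sum Σₑ g(e) Xₑ / p has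
-- expectation Σₑ g(e); hence E[X_q(v)] = q Σ_{e ∋ v} |Δₑ| + (1 − 2q) |{e : v ∈ Nₑ}|.  Both terms count
-- the triangles at v: each of them has exactly two edges at v, so Σ_{e ∋ v} |Δₑ| = 2|Δᵥ|, and the edges
-- e with v ∈ Nₑ are exactly the edges opposite to v, so there are |Δᵥ| of them.  Altogether
-- E[X_q(v)] = 2q|Δᵥ| + (1 − 2q)|Δᵥ| = |Δᵥ|.
-- Edges and triangles are listed as increasing tuples, so the counts become sums of indicators over
-- Fin n, and the one fact about the order that is needed is that a node x ∉ {a, b} lies before,
-- between or after a < b in exactly one way.

private variable
  A : Set
  k : ℕ

-- Not refl: ⌊_⌋ is stricter than `does` and does not see through the map′ in Fin's _≟_.
suc-=ᵇ-suc : ∀ (i j : Fin k) → (suc i =ᵇ suc j) ≡ (i =ᵇ j)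
suc-=ᵇ-suc i j with i ≟ j
... | yes _ = ≡.refl
... | no  _ = ≡.refl

=ᵇ-sym : ∀ (i j : Fin k) → (i =ᵇ j) ≡ (j =ᵇ i)
=ᵇ-sym i j with i ≟ j | j ≟ i
... | yes _      | yes _      = ≡.refl
... | no  _      | no  _      = ≡.refl
... | yes ≡.refl | no  i≢i    = contradiction ≡.refl i≢i
... | no  i≢i    | yes ≡.refl = contradiction ≡.refl i≢i

All-if : ∀ {P : A → Set} b {x} → (T b → P x) → All P (if b then x ∷ [] else [])
All-if false _  = []
All-if true  Px = Px _ ∷ []

module SemiringSums {c ℓ} (R : CommutativeSemiring c ℓ) where

  open CommutativeSemiring R hiding (zero)
  open import Algebra.Properties.Semiring.Sum semiring
    using (sum-syntax; sum-cong-≋; sum-cong-≗; sum-replicate-zero)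
  open import Algebra.Properties.CommutativeSemigroup +-commutativeSemigroup using (interchange)
  open import Relation.Binary.Reasoning.Setoid setoid

  private variable
    B : Set
    n : ℕ

  Σ : List Carrier → Carrier
  Σ = foldr _+_ 0#

  ι : Bool → Carrier
  ι b = if b then 1# else 0#

  ι-∧ : ∀ p q → ι (p ∧ q) ≈ ι p * ι q
  ι-∧ false q = sym (zeroˡ (ι q))
  ι-∧ true  q = sym (*-identityˡ (ι q))

  Σ-cong-All : ∀ {f g : A → Carrier} {xs} → All (λ x → f x ≈ g x) xs → Σ (map f xs) ≈ Σ (map g xs)
  Σ-cong-All []            = refl
  Σ-cong-All (fx≈gx ∷ eqs) = +-cong fx≈gx (Σ-cong-All eqs)

  Σ-cong : ∀ {f g : A → Carrier} → (∀ x → f x ≈ g x) → ∀ xs → Σ (map f xs) ≈ Σ (map g xs)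
  Σ-cong f≈g xs = Σ-cong-All (universal f≈g xs)

  Σ-0 : ∀ (xs : List A) → Σ (map (λ _ → 0#) xs) ≈ 0#
  Σ-0 []       = refl
  Σ-0 (x ∷ xs) = trans (+-identityˡ _) (Σ-0 xs)

  Σ-++ : ∀ xs ys → Σ (xs ++ ys) ≈ Σ xs + Σ ys
  Σ-++ []       ys = sym (+-identityˡ (Σ ys))
  Σ-++ (x ∷ xs) ys = trans (+-congˡ (Σ-++ xs ys)) (sym (+-assoc x (Σ xs) (Σ ys)))

  Σ-+ : ∀ (f g : A → Carrier) xs → Σ (map (λ x → f x + g x) xs) ≈ Σ (map f xs) + Σ (map g xs)
  Σ-+ f g []       = sym (+-identityˡ 0#)
  Σ-+ f g (x ∷ xs) = trans (+-congˡ (Σ-+ f g xs)) (interchange (f x) (g x) _ _)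

  Σ-*ˡ : ∀ c (f : A → Carrier) xs → Σ (map (λ x → c * f x) xs) ≈ c * Σ (map f xs)
  Σ-*ˡ c f []       = sym (zeroʳ c)
  Σ-*ˡ c f (x ∷ xs) = trans (+-congˡ (Σ-*ˡ c f xs)) (sym (distribˡ c (f x) _))

  Σ-swap : ∀ (f : A → B → Carrier) xs ys →
           Σ (map (λ x → Σ (map (f x) ys)) xs) ≈ Σ (map (λ y → Σ (map (λ x → f x y) xs)) ys)
  Σ-swap f []       ys = sym (Σ-0 ys)
  Σ-swap f (x ∷ xs) ys = trans (+-congˡ (Σ-swap f xs ys)) (sym (Σ-+ (f x) _ ys))

  Σ-filterᵇ : ∀ (f : A → Carrier) P xs → Σ (map f (filterᵇ P xs)) ≈ Σ (map (λ x → ι (P x) * f x) xs)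
  Σ-filterᵇ f P []       = refl
  Σ-filterᵇ f P (x ∷ xs) with P x
  ... | true  = +-cong (sym (*-identityˡ (f x))) (Σ-filterᵇ f P xs)
  ... | false = trans (Σ-filterᵇ f P xs) (trans (sym (+-identityˡ _)) (+-congʳ (sym (zeroˡ (f x)))))

  Σ-if : ∀ (f : A → Carrier) b x → Σ (map f (if b then x ∷ [] else [])) ≈ ι b * f x
  Σ-if f false x = sym (zeroˡ (f x))
  Σ-if f true  x = trans (+-identityʳ (f x)) (sym (*-identityˡ (f x)))

  Σ-concatMap : ∀ (f : B → Carrier) (g : A → List B) xs →
                Σ (map f (concatMap g xs)) ≈ Σ (map (λ x → Σ (map f (g x))) xs)
  Σ-concatMap f g []       = refl
  Σ-concatMap f g (x ∷ xs) = begin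
    Σ (map f (g x ++ concatMap g xs))                      ≡⟨ ≡.cong Σ (map-++ f (g x) _) ⟩
    Σ (map f (g x) ++ map f (concatMap g xs))              ≈⟨ Σ-++ (map f (g x)) _ ⟩
    Σ (map f (g x)) + Σ (map f (concatMap g xs))           ≈⟨ +-congˡ (Σ-concatMap f g xs) ⟩
    Σ (map f (g x)) + Σ (map (λ x → Σ (map f (g x))) xs)  ∎

  Σ-tabulate : ∀ (f : Fin n → Carrier) → Σ (tabulate f) ≈ ∑[ i < n ] f i
  Σ-tabulate {ℕ.zero} f = refl
  Σ-tabulate {ℕ.suc n} f = +-congˡ (Σ-tabulate (f ∘ suc))

  Σ-allFin : ∀ (f : Fin n → Carrier) → Σ (map f (allFin n)) ≈ ∑[ i < n ] f i
  Σ-allFin f = trans (reflexive (≡.cong Σ (map-tabulate (λ i → i) f))) (Σ-tabulate f)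

  Σ-concatMap-allFin : ∀ (f : B → Carrier) (g : Fin n → List B) →
                       Σ (map f (concatMap g (allFin n))) ≈ ∑[ i < n ] Σ (map f (g i))
  Σ-concatMap-allFin {n = n} f g = trans (Σ-concatMap f g (allFin n)) (Σ-allFin (λ i → Σ (map f (g i))))

  ∑-δ : ∀ (i : Fin n) (f : Fin n → Carrier) → ∑[ j < n ] (f j * ι (i =ᵇ j)) ≈ f i
  ∑-δ {ℕ.suc n} zero    f = begin
    f zero * 1# + ∑[ j < n ] (f (suc j) * 0#)
      ≈⟨ +-cong (*-identityʳ (f zero)) (trans (sum-cong-≋ (λ j → zeroʳ (f (suc j)))) (sum-replicate-zero n)) ⟩
    f zero + 0#
      ≈⟨ +-identityʳ (f zero) ⟩
    f zero ∎
  ∑-δ {ℕ.suc n} (suc i) f = begin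
    f zero * 0# + ∑[ j < n ] (f (suc j) * ι (suc i =ᵇ suc j))
      ≡⟨ ≡.cong (f zero * 0# +_) (sum-cong-≗ λ j → ≡.cong (λ b → f (suc j) * ι b) (suc-=ᵇ-suc i j)) ⟩
    f zero * 0# + ∑[ j < n ] (f (suc j) * ι (i =ᵇ j))
      ≈⟨ +-cong (zeroʳ (f zero)) (∑-δ i (f ∘ suc)) ⟩
    0# + f (suc i)
      ≈⟨ +-identityˡ (f (suc i)) ⟩
    f (suc i) ∎

module _ {n : ℕ} (G : Graph n) where

  isEdge : Fin n → Fin n → Bool
  isEdge a b = (a <ᶠ b) ∧ adj G a b

  clique : Fin n → Fin n → Fin n → Bool
  clique u v w = adj G u v ∧ adj G v w ∧ adj G w u

  isTriangle : Fin n → Fin n → Fin n → Bool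
  isTriangle u v w = (u <ᶠ v) ∧ (v <ᶠ w) ∧ clique u v w

module GraphSums {c ℓ} (R : CommutativeSemiring c ℓ) {n : ℕ} (G : Graph n) where

  open CommutativeSemiring R using (Carrier; _≈_; _*_; trans)
  open SemiringSums R
  open import Algebra.Properties.Semiring.Sum (CommutativeSemiring.semiring R) using (sum-syntax; sum-cong-≋)

  Σ-E : ∀ (f : Edge G → Carrier) → Σ (map f (E G)) ≈ ∑[ a < n ] ∑[ b < n ] (ι (isEdge G a b) * f (a , b))
  Σ-E f = trans (Σ-concatMap-allFin {n = n} f _) (sum-cong-≋ λ a →
          trans (Σ-concatMap-allFin {n = n} f _) (sum-cong-≋ λ b →
          Σ-if f (isEdge G a b) (a , b)))

  Σ-Triangles : ∀ (f : Triangle G → Carrier) →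
                Σ (map f (Triangles G))
                ≈ ∑[ u < n ] ∑[ v < n ] ∑[ w < n ] (ι (isTriangle G u v w) * f (u , v , w))
  Σ-Triangles f = trans (Σ-concatMap-allFin {n = n} f _) (sum-cong-≋ λ u →
                  trans (Σ-concatMap-allFin {n = n} f _) (sum-cong-≋ λ v →
                  trans (Σ-concatMap-allFin {n = n} f _) (sum-cong-≋ λ w →
                  Σ-if f (isTriangle G u v w) (u , v , w))))

open ≡ using (refl; sym; trans; cong; cong₂; subst; module ≡-Reasoning)

module NatIndicators where

  open import Data.Nat using (_<ᵇ_; _+_; _*_)
  open import Data.Nat.Properties
    using (+-*-commutativeSemiring; +-*-semiring; *-distribˡ-+;
           <ᵇ-reflects-<; <-asym; <-trans; ≤-antisym; ≤-trans; ≮⇒≥; <⇒≱)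
  open import Algebra.Properties.Semiring.Sum +-*-semiring
    using (sum-syntax; ∑-distrib-+; *-distribʳ-sum) renaming (sum-cong-≗ to ∑-cong)
  open SemiringSums +-*-commutativeSemiring public

  ι-not : ∀ b → ι b + ι (not b) ≡ 1
  ι-not false = refl
  ι-not true  = refl

  ι*-cong : ∀ b {x y} → (T b → x ≡ y) → ι b * x ≡ ι b * y
  ι*-cong false x≡y = refl
  ι*-cong true  x≡y = cong (_+ 0) (x≡y _)

  *-distribˡ-+₃ : ∀ a x y z → a * (x + y + z) ≡ a * x + a * y + a * z
  *-distribˡ-+₃ a x y z = trans (*-distribˡ-+ a (x + y) z) (cong (_+ a * z) (*-distribˡ-+ a x y))

  length-filterᵇ : ∀ (P : A → Bool) xs → length (filterᵇ P xs) ≡ Σ (map (ι ∘ P) xs)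
  length-filterᵇ P []       = refl
  length-filterᵇ P (x ∷ xs) with P x
  ... | true  = cong (1 +_) (length-filterᵇ P xs)
  ... | false = length-filterᵇ P xs

  <ᵇ-flip : ∀ {m n} → m ≢ n → (n <ᵇ m) ≡ not (m <ᵇ n)
  <ᵇ-flip {m} {n} m≢n with m <ᵇ n | <ᵇ-reflects-< m n | n <ᵇ m | <ᵇ-reflects-< n m
  ... | true  | ofʸ m<n | true  | ofʸ n<m = contradiction n<m (<-asym m<n)
  ... | true  | _       | false | _       = refl
  ... | false | _       | true  | _       = refl
  ... | false | ofⁿ m≮n | false | ofⁿ n≮m = contradiction (≤-antisym (≮⇒≥ n≮m) (≮⇒≥ m≮n)) m≢n

  <ᵇ-between : ∀ {x a b} → x ≢ a → x ≢ b →
               ι ((x <ᵇ a) ∧ (a <ᵇ b)) + ι ((a <ᵇ x) ∧ (x <ᵇ b)) + ι ((a <ᵇ b) ∧ (b <ᵇ x)) ≡ ι (a <ᵇ b)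
  <ᵇ-between {x} {a} {b} x≢a x≢b
    rewrite <ᵇ-flip (x≢a ∘ sym) | <ᵇ-flip x≢b
    with a <ᵇ b | <ᵇ-reflects-< a b | a <ᵇ x | <ᵇ-reflects-< a x | x <ᵇ b | <ᵇ-reflects-< x b
  ... | false | ofⁿ a≮b | true  | ofʸ a<x | true  | ofʸ x<b = contradiction (<-trans a<x x<b) a≮b
  ... | true  | ofʸ a<b | false | ofⁿ a≮x | false | ofⁿ x≮b =
    contradiction (≤-trans (≮⇒≥ x≮b) (≮⇒≥ a≮x)) (<⇒≱ a<b)
  ... | false | _ | false | _ | _     | _ = refl
  ... | false | _ | true  | _ | false | _ = refl
  ... | true  | _ | true  | _ | true  | _ = refl
  ... | true  | _ | true  | _ | false | _ = refl
  ... | true  | _ | false | _ | true  | _ = refl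

  <ᶠ-flip : ∀ {i j : Fin k} → i ≢ j → (j <ᶠ i) ≡ not (i <ᶠ j)
  <ᶠ-flip i≢j = <ᵇ-flip (i≢j ∘ toℕ-injective)

  *-distribʳ-∑∑ : ∀ {m n} c (f : Fin m → Fin n → ℕ) →
                  (∑[ i < m ] ∑[ j < n ] f i j) * c ≡ ∑[ i < m ] ∑[ j < n ] (f i j * c)
  *-distribʳ-∑∑ c f = trans (*-distribʳ-sum c (λ i → ∑[ j < _ ] f i j)) (∑-cong λ i → *-distribʳ-sum c (f i))

  ∑∑-distrib-+ : ∀ {m n} (f g : Fin m → Fin n → ℕ) →
                 ∑[ i < m ] ∑[ j < n ] (f i j + g i j) ≡ ∑[ i < m ] ∑[ j < n ] f i j + ∑[ i < m ] ∑[ j < n ] g i j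
  ∑∑-distrib-+ f g = trans (∑-cong λ i → ∑-distrib-+ (f i) (g i))
                           (∑-distrib-+ (λ i → ∑[ j < _ ] f i j) (λ i → ∑[ j < _ ] g i j))

  ∑-distrib-+₃ : ∀ {m} (f g h : Fin m → ℕ) →
                 ∑[ i < m ] (f i + g i + h i) ≡ ∑[ i < m ] f i + ∑[ i < m ] g i + ∑[ i < m ] h i
  ∑-distrib-+₃ f g h = trans (∑-distrib-+ (λ i → f i + g i) h) (cong (_+ ∑[ i < _ ] h i) (∑-distrib-+ f g))

  ∑∑-distrib-+₃ : ∀ {m n} (f g h : Fin m → Fin n → ℕ) →
                  ∑[ i < m ] ∑[ j < n ] (f i j + g i j + h i j)
                  ≡ ∑[ i < m ] ∑[ j < n ] f i j + ∑[ i < m ] ∑[ j < n ] g i j + ∑[ i < m ] ∑[ j < n ] h i j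
  ∑∑-distrib-+₃ f g h = trans (∑-cong λ i → ∑-distrib-+₃ (f i) (g i) (h i))
    (∑-distrib-+₃ (λ i → ∑[ j < _ ] f i j) (λ i → ∑[ j < _ ] g i j) (λ i → ∑[ j < _ ] h i j))

module TriangleCounts {n : ℕ} (G : Graph n) where

  open import Data.Nat using (_+_; _*_)
  open import Data.Nat.Properties
    using (+-*-commutativeSemiring; +-*-semiring; *-commutativeSemigroup;
           *-comm; *-identityʳ; +-identityʳ; *-distribʳ-+)
  open import Algebra.Properties.Semiring.Sum +-*-semiring
    using (sum-syntax; ∑-distrib-+; *-distribˡ-sum; *-distribʳ-sum) renaming (sum-cong-≗ to ∑-cong)
  open import Algebra.Properties.CommutativeSemigroup *-commutativeSemigroup using (x∙yz≈y∙xz; x∙yz≈xz∙y)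
  open import Algebra.Solver.CommutativeMonoid ∧-commutativeMonoid using (solve; _⊕_; _⊜_)
  open import Data.Nat.Tactic.RingSolver using (solve-∀)
  open NatIndicators
  open GraphSums +-*-commutativeSemiring G
  open ≡-Reasoning

  private variable
    a b u v w : Fin n

  tri : Fin n → Fin n → Fin n → ℕ
  tri u v w = ι (isTriangle G u v w)

  IsEdge : Edge G → Set
  IsEdge (a , b) = T (isEdge G a b)

  IsClique : Triangle G → Set
  IsClique (u , v , w) = T (clique G u v w)

  adj⇒≢ : T (adj G a b) → a ≢ b
  adj⇒≢ {a} adj-aa refl = subst T (adj-irr G a) adj-aa

  clique⇒adj : T (clique G u v w) → T (adj G u v) × T (adj G v w) × T (adj G w u)
  clique⇒adj c with to T-∧ c
  ... | uv , c′ = uv , to T-∧ c′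

  clique⇒≢ : T (clique G u v w) → u ≢ v × v ≢ w × w ≢ u
  clique⇒≢ c with clique⇒adj c
  ... | uv , vw , wu = adj⇒≢ uv , adj⇒≢ vw , adj⇒≢ wu

  isTriangle⇒clique : T (isTriangle G u v w) → T (clique G u v w)
  isTriangle⇒clique {u} {v} {w} t = proj₂ (to (T-∧ {v <ᶠ w}) (proj₂ (to (T-∧ {u <ᶠ v}) t)))

  E-edges : All IsEdge (E G)
  E-edges = concat⁺ (map⁺ (tabulate⁺ λ a → concat⁺ (map⁺ (tabulate⁺ λ b →
            All-if (isEdge G a b) (λ e → e)))))

  Triangles-cliques : All IsClique (Triangles G)
  Triangles-cliques =
    concat⁺ (map⁺ (tabulate⁺ λ u → concat⁺ (map⁺ (tabulate⁺ λ v → concat⁺ (map⁺ (tabulate⁺ λ w →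
    All-if (isTriangle G u v w) (isTriangle⇒clique {u} {v} {w})))))))

  clique-rotate : ∀ u v w → clique G u v w ≡ clique G v w u
  clique-rotate u v w = trans (∧-comm (adj G u v) _) (∧-assoc (adj G v w) (adj G w u) (adj G u v))

  clique-swap : ∀ u v w → clique G u v w ≡ clique G v u w
  clique-swap u v w rewrite adj-sym G v u | adj-sym G w v | adj-sym G u w =
    cong (adj G u v ∧_) (∧-comm (adj G v w) (adj G w u))

  tri≡clique*sorted : ∀ u v w → tri u v w ≡ ι (clique G u v w) * ι ((u <ᶠ v) ∧ (v <ᶠ w))
  tri≡clique*sorted u v w = trans
    (cong ι (solve 3 (λ s t c → s ⊕ (t ⊕ c) ⊜ c ⊕ (s ⊕ t)) refl (u <ᶠ v) (v <ᶠ w) (clique G u v w)))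
    (ι-∧ (clique G u v w) _)

  isEdge∧∈ᴺ : ∀ a b x → (isEdge G a b ∧ _∈ᴺ_ G x (a , b)) ≡ (clique G x a b ∧ (a <ᶠ b))
  isEdge∧∈ᴺ a b x rewrite adj-sym G x a =
    solve 4 (λ s p q r → (s ⊕ p) ⊕ (q ⊕ r) ⊜ (q ⊕ (p ⊕ r)) ⊕ s) refl (a <ᶠ b) (adj G a b) (adj G a x) (adj G b x)

  edge-∈ᴺ≡triangles : ∀ a b x → ι (isEdge G a b) * ι (_∈ᴺ_ G x (a , b)) ≡ tri x a b + tri a x b + tri a b x
  edge-∈ᴺ≡triangles a b x = begin
    ι (isEdge G a b) * ι (_∈ᴺ_ G x (a , b))  ≡⟨ sym (ι-∧ (isEdge G a b) _) ⟩
    ι (isEdge G a b ∧ _∈ᴺ_ G x (a , b))      ≡⟨ cong ι (isEdge∧∈ᴺ a b x) ⟩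
    ι (K ∧ (a <ᶠ b))                          ≡⟨ ι-∧ K _ ⟩
    ι K * ι (a <ᶠ b)                          ≡⟨ ι*-cong K (sym ∘ between) ⟩
    ι K * (ι s₁ + ι s₂ + ι s₃)               ≡⟨ *-distribˡ-+₃ (ι K) (ι s₁) (ι s₂) (ι s₃) ⟩
    ι K * ι s₁ + ι K * ι s₂ + ι K * ι s₃     ≡⟨ sym (cong₂ _+_ (cong₂ _+_ first middle) last) ⟩
    tri x a b + tri a x b + tri a b x         ∎
    where
    K  = clique G x a b
    s₁ = (x <ᶠ a) ∧ (a <ᶠ b)
    s₂ = (a <ᶠ x) ∧ (x <ᶠ b)
    s₃ = (a <ᶠ b) ∧ (b <ᶠ x)
    between : T K → ι s₁ + ι s₂ + ι s₃ ≡ ι (a <ᶠ b)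
    between k with clique⇒≢ k
    ... | x≢a , _ , b≢x = <ᵇ-between (x≢a ∘ toℕ-injective) (b≢x ∘ sym ∘ toℕ-injective)
    first : tri x a b ≡ ι K * ι s₁
    first = tri≡clique*sorted x a b
    middle : tri a x b ≡ ι K * ι s₂
    middle = trans (tri≡clique*sorted a x b) (cong (λ c → ι c * ι s₂) (sym (clique-swap x a b)))
    last : tri a b x ≡ ι K * ι s₃
    last = trans (tri≡clique*sorted a b x) (cong (λ c → ι c * ι s₃) (sym (clique-rotate x a b)))

  ∈ᵗ-split : ∀ x → u ≢ v → v ≢ w → w ≢ u →
             ι (_∈ᵗ_ G x (u , v , w)) ≡ ι (x =ᵇ u) + ι (x =ᵇ v) + ι (x =ᵇ w)
  ∈ᵗ-split {u} {v} {w} x u≢v v≢w w≢u with x ≟ u | x ≟ v | x ≟ w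
  ... | yes refl | yes refl | _        = contradiction refl u≢v
  ... | yes refl | no _     | yes refl = contradiction refl w≢u
  ... | no _     | yes refl | yes refl = contradiction refl v≢w
  ... | yes _    | no _     | no _     = refl
  ... | no _     | yes _    | no _     = refl
  ... | no _     | no _     | yes _    = refl
  ... | no _     | no _     | no _     = refl

  ∈ᵉ-split : ∀ x → a ≢ b → ι (_∈ᵉ_ G x (a , b)) ≡ ι (x =ᵇ a) + ι (x =ᵇ b)
  ∈ᵉ-split {a} {b} x a≢b with x ≟ a | x ≟ b
  ... | yes refl | yes refl = contradiction refl a≢b
  ... | yes _    | no _     = refl
  ... | no _     | yes _    = refl
  ... | no _     | no _     = refl

  Δᵥ-by-position : ∀ x → Δᵥ G x ≡ ∑[ a < n ] ∑[ b < n ] (tri x a b + tri a x b + tri a b x)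
  Δᵥ-by-position x = begin
    Δᵥ G x
      ≡⟨ length-filterᵇ (_∈ᵗ_ G x) (Triangles G) ⟩
    Σ (map (ι ∘ _∈ᵗ_ G x) (Triangles G))
      ≡⟨ Σ-cong-All (All.map split Triangles-cliques) ⟩
    Σ (map (λ t → at₁ t + at₂ t + at₃ t) (Triangles G))
      ≡⟨ Σ-+ (λ t → at₁ t + at₂ t) at₃ (Triangles G) ⟩
    Σ (map (λ t → at₁ t + at₂ t) (Triangles G)) + Σ (map at₃ (Triangles G))
      ≡⟨ cong (_+ Σ (map at₃ (Triangles G))) (Σ-+ at₁ at₂ (Triangles G)) ⟩
    Σ (map at₁ (Triangles G)) + Σ (map at₂ (Triangles G)) + Σ (map at₃ (Triangles G))
      ≡⟨ cong₂ _+_ (cong₂ _+_ first second) third ⟩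
    ∑[ a < n ] ∑[ b < n ] tri x a b + ∑[ a < n ] ∑[ b < n ] tri a x b + ∑[ a < n ] ∑[ b < n ] tri a b x
      ≡⟨ sym (∑∑-distrib-+₃ (λ a b → tri x a b) (λ a b → tri a x b) (λ a b → tri a b x)) ⟩
    ∑[ a < n ] ∑[ b < n ] (tri x a b + tri a x b + tri a b x) ∎
    where
    at₁ at₂ at₃ : Triangle G → ℕ
    at₁ t = ι (x =ᵇ proj₁ t)
    at₂ t = ι (x =ᵇ proj₁ (proj₂ t))
    at₃ t = ι (x =ᵇ proj₂ (proj₂ t))
    split : ∀ {t} → IsClique t → ι (_∈ᵗ_ G x t) ≡ at₁ t + at₂ t + at₃ t
    split {u , v , w} c with clique⇒≢ c
    ... | u≢v , v≢w , w≢u = ∈ᵗ-split x u≢v v≢w w≢u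
    first : Σ (map at₁ (Triangles G)) ≡ ∑[ v < n ] ∑[ w < n ] tri x v w
    first = trans (Σ-Triangles at₁) (trans
      (∑-cong λ u → sym (*-distribʳ-∑∑ (ι (x =ᵇ u)) (tri u)))
      (∑-δ x (λ u → ∑[ v < n ] ∑[ w < n ] tri u v w)))
    second : Σ (map at₂ (Triangles G)) ≡ ∑[ u < n ] ∑[ w < n ] tri u x w
    second = trans (Σ-Triangles at₂) (∑-cong λ u → trans
      (∑-cong λ v → sym (*-distribʳ-sum (ι (x =ᵇ v)) (tri u v)))
      (∑-δ x (λ v → ∑[ w < n ] tri u v w)))
    third : Σ (map at₃ (Triangles G)) ≡ ∑[ u < n ] ∑[ v < n ] tri u v x
    third = trans (Σ-Triangles at₃) (∑-cong λ u → ∑-cong λ v → ∑-δ x (tri u v))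

  length-∈ᴺ-edges≡Δᵥ : ∀ x → length (filterᵇ (_∈ᴺ_ G x) (E G)) ≡ Δᵥ G x
  length-∈ᴺ-edges≡Δᵥ x = begin
    length (filterᵇ (_∈ᴺ_ G x) (E G))
      ≡⟨ length-filterᵇ (_∈ᴺ_ G x) (E G) ⟩
    Σ (map (ι ∘ _∈ᴺ_ G x) (E G))
      ≡⟨ Σ-E (ι ∘ _∈ᴺ_ G x) ⟩
    ∑[ a < n ] ∑[ b < n ] (ι (isEdge G a b) * ι (_∈ᴺ_ G x (a , b)))
      ≡⟨ ∑-cong (λ a → ∑-cong λ b → edge-∈ᴺ≡triangles a b x) ⟩
    ∑[ a < n ] ∑[ b < n ] (tri x a b + tri a x b + tri a b x)
      ≡⟨ sym (Δᵥ-by-position x) ⟩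
    Δᵥ G x ∎

  isEdge-orientations : ∀ a b → ι (isEdge G a b) + ι (isEdge G b a) ≡ ι (adj G a b)
  isEdge-orientations a b = begin
    ι (isEdge G a b) + ι (isEdge G b a)
      ≡⟨ cong₂ _+_ (ι-∧ (a <ᶠ b) (adj G a b))
                   (trans (ι-∧ (b <ᶠ a) (adj G b a)) (cong (λ c → ι (b <ᶠ a) * ι c) (adj-sym G b a))) ⟩
    ι (a <ᶠ b) * ι (adj G a b) + ι (b <ᶠ a) * ι (adj G a b)
      ≡⟨ sym (*-distribʳ-+ (ι (adj G a b)) (ι (a <ᶠ b)) _) ⟩
    (ι (a <ᶠ b) + ι (b <ᶠ a)) * ι (adj G a b)
      ≡⟨ *-comm _ (ι (adj G a b)) ⟩
    ι (adj G a b) * (ι (a <ᶠ b) + ι (b <ᶠ a))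
      ≡⟨ ι*-cong (adj G a b) one-orientation ⟩
    ι (adj G a b) * 1
      ≡⟨ *-identityʳ _ ⟩
    ι (adj G a b) ∎
    where
    one-orientation : T (adj G a b) → ι (a <ᶠ b) + ι (b <ᶠ a) ≡ 1
    one-orientation e = trans (cong (λ c → ι (a <ᶠ b) + ι c) (<ᶠ-flip (adj⇒≢ e))) (ι-not (a <ᶠ b))

  Σ-edges-at : ∀ x (f : Edge G → ℕ) → (∀ a b → f (a , b) ≡ f (b , a)) →
               Σ (map f (filterᵇ (_∈ᵉ_ G x) (E G))) ≡ ∑[ b < n ] (ι (adj G x b) * f (x , b))
  Σ-edges-at x f f-sym = begin
    Σ (map f (filterᵇ (_∈ᵉ_ G x) (E G)))
      ≡⟨ Σ-filterᵇ f (_∈ᵉ_ G x) (E G) ⟩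
    Σ (map (λ e → ι (_∈ᵉ_ G x e) * f e) (E G))
      ≡⟨ Σ-E _ ⟩
    ∑[ a < n ] ∑[ b < n ] (ι (isEdge G a b) * (ι (_∈ᵉ_ G x (a , b)) * f (a , b)))
      ≡⟨ ∑-cong (λ a → ∑-cong λ b → split a b) ⟩
    ∑[ a < n ] ∑[ b < n ] (g a b * ι (x =ᵇ a) + g a b * ι (x =ᵇ b))
      ≡⟨ ∑∑-distrib-+ (λ a b → g a b * ι (x =ᵇ a)) (λ a b → g a b * ι (x =ᵇ b)) ⟩
    ∑[ a < n ] ∑[ b < n ] (g a b * ι (x =ᵇ a)) + ∑[ a < n ] ∑[ b < n ] (g a b * ι (x =ᵇ b))
      ≡⟨ cong₂ _+_ from-x to-x ⟩
    ∑[ b < n ] g x b + ∑[ a < n ] g a x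
      ≡⟨ sym (∑-distrib-+ (g x) (λ b → g b x)) ⟩
    ∑[ b < n ] (g x b + g b x)
      ≡⟨ ∑-cong orient ⟩
    ∑[ b < n ] (ι (adj G x b) * f (x , b)) ∎
    where
    g : Fin n → Fin n → ℕ
    g a b = ι (isEdge G a b) * f (a , b)
    rearrange : ∀ k p q y → k * ((p + q) * y) ≡ k * y * p + k * y * q
    rearrange = solve-∀
    split : ∀ a b → ι (isEdge G a b) * (ι (_∈ᵉ_ G x (a , b)) * f (a , b)) ≡ g a b * ι (x =ᵇ a) + g a b * ι (x =ᵇ b)
    split a b = trans
      (ι*-cong (isEdge G a b) λ e → cong (_* f (a , b)) (∈ᵉ-split x (adj⇒≢ (proj₂ (to (T-∧ {a <ᶠ b}) e)))))
      (rearrange (ι (isEdge G a b)) (ι (x =ᵇ a)) (ι (x =ᵇ b)) (f (a , b)))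
    from-x : ∑[ a < n ] ∑[ b < n ] (g a b * ι (x =ᵇ a)) ≡ ∑[ b < n ] g x b
    from-x = trans (∑-cong λ a → sym (*-distribʳ-sum (ι (x =ᵇ a)) (g a))) (∑-δ x (λ a → ∑[ b < n ] g a b))
    to-x : ∑[ a < n ] ∑[ b < n ] (g a b * ι (x =ᵇ b)) ≡ ∑[ a < n ] g a x
    to-x = ∑-cong λ a → ∑-δ x (g a)
    orient : ∀ b → g x b + g b x ≡ ι (adj G x b) * f (x , b)
    orient b = begin
      ι (isEdge G x b) * f (x , b) + ι (isEdge G b x) * f (b , x)
        ≡⟨ cong (λ y → ι (isEdge G x b) * f (x , b) + ι (isEdge G b x) * y) (f-sym b x) ⟩
      ι (isEdge G x b) * f (x , b) + ι (isEdge G b x) * f (x , b)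
        ≡⟨ sym (*-distribʳ-+ (f (x , b)) (ι (isEdge G x b)) (ι (isEdge G b x))) ⟩
      (ι (isEdge G x b) + ι (isEdge G b x)) * f (x , b)
        ≡⟨ cong (_* f (x , b)) (isEdge-orientations x b) ⟩
      ι (adj G x b) * f (x , b) ∎

  adj-in-triangle : ∀ x → T (clique G u v w) → T (_∈ᵗ_ G x (u , v , w)) →
                    ι (adj G x u) + ι (adj G x v) + ι (adj G x w) ≡ 2
  adj-in-triangle {u} {v} {w} x c x∈t with clique⇒adj c | x ≟ u | x ≟ v | x ≟ w
  ... | uv , vw , wu | yes refl | _ | _
    rewrite adj-irr G x | to T-≡ uv | trans (adj-sym G x w) (to T-≡ wu) = refl
  ... | uv , vw , wu | no _ | yes refl | _
    rewrite adj-irr G x | to T-≡ vw | trans (adj-sym G x u) (to T-≡ uv) = refl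
  ... | uv , vw , wu | no _ | no _ | yes refl
    rewrite adj-irr G x | to T-≡ wu | trans (adj-sym G x v) (to T-≡ vw) = refl
  ... | _ | no _ | no _ | no _ = ⊥-elim x∈t

  triangle-degree : ∀ x {t} → IsClique t →
                    ∑[ b < n ] (ι (adj G x b) * ι (_∈ᵗ_ G x t ∧ _∈ᵗ_ G b t))
                    ≡ ι (_∈ᵗ_ G x t) + ι (_∈ᵗ_ G x t)
  triangle-degree x {t@(u , v , w)} c = begin
    ∑[ b < n ] (N b * ι (x∈t ∧ _∈ᵗ_ G b t))
      ≡⟨ ∑-cong (λ b → trans (cong (N b *_) (ι-∧ x∈t _)) (x∙yz≈y∙xz (N b) (ι x∈t) (ι (_∈ᵗ_ G b t)))) ⟩
    ∑[ b < n ] (ι x∈t * (N b * ι (_∈ᵗ_ G b t)))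
      ≡⟨ sym (*-distribˡ-sum (ι x∈t) (λ b → N b * ι (_∈ᵗ_ G b t))) ⟩
    ι x∈t * ∑[ b < n ] (N b * ι (_∈ᵗ_ G b t))
      ≡⟨ ι*-cong x∈t (trans neighbours-of-x ∘ adj-in-triangle x c) ⟩
    ι x∈t * 2
      ≡⟨ trans (*-comm (ι x∈t) 2) (cong (ι x∈t +_) (+-identityʳ (ι x∈t))) ⟩
    ι x∈t + ι x∈t ∎
    where
    x∈t = _∈ᵗ_ G x t
    N : Fin n → ℕ
    N b = ι (adj G x b)
    distribute : ∀ b → N b * (ι (b =ᵇ u) + ι (b =ᵇ v) + ι (b =ᵇ w))
                       ≡ N b * ι (u =ᵇ b) + N b * ι (v =ᵇ b) + N b * ι (w =ᵇ b)
    distribute b rewrite =ᵇ-sym b u | =ᵇ-sym b v | =ᵇ-sym b w = *-distribˡ-+₃ (N b) _ _ _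
    neighbours-of-x : ∑[ b < n ] (N b * ι (_∈ᵗ_ G b t)) ≡ N u + N v + N w
    neighbours-of-x with clique⇒≢ c
    ... | u≢v , v≢w , w≢u = begin
      ∑[ b < n ] (N b * ι (_∈ᵗ_ G b t))
        ≡⟨ ∑-cong (λ b → trans (cong (N b *_) (∈ᵗ-split b u≢v v≢w w≢u)) (distribute b)) ⟩
      ∑[ b < n ] (N b * ι (u =ᵇ b) + N b * ι (v =ᵇ b) + N b * ι (w =ᵇ b))
        ≡⟨ ∑-distrib-+₃ (λ b → N b * ι (u =ᵇ b)) (λ b → N b * ι (v =ᵇ b)) (λ b → N b * ι (w =ᵇ b)) ⟩
      ∑[ b < n ] (N b * ι (u =ᵇ b)) + ∑[ b < n ] (N b * ι (v =ᵇ b)) + ∑[ b < n ] (N b * ι (w =ᵇ b))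
        ≡⟨ cong₂ _+_ (cong₂ _+_ (∑-δ u N) (∑-δ v N)) (∑-δ w N) ⟩
      N u + N v + N w ∎

  ∑-adj-Δₑ≡2Δᵥ : ∀ x → ∑[ b < n ] (ι (adj G x b) * Δₑ G (x , b)) ≡ Δᵥ G x + Δᵥ G x
  ∑-adj-Δₑ≡2Δᵥ x = begin
    ∑[ b < n ] (ι (adj G x b) * Δₑ G (x , b))
      ≡⟨ ∑-cong (λ b → trans (cong (ι (adj G x b) *_) (length-filterᵇ _ (Triangles G)))
                             (sym (Σ-*ˡ (ι (adj G x b)) _ (Triangles G)))) ⟩
    ∑[ b < n ] Σ (map (F b) (Triangles G))
      ≡⟨ sym (Σ-allFin (λ b → Σ (map (F b) (Triangles G)))) ⟩
    Σ (map (λ b → Σ (map (F b) (Triangles G))) (allFin n))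
      ≡⟨ Σ-swap F (allFin n) (Triangles G) ⟩
    Σ (map (λ t → Σ (map (λ b → F b t) (allFin n))) (Triangles G))
      ≡⟨ Σ-cong (λ t → Σ-allFin (λ b → F b t)) (Triangles G) ⟩
    Σ (map (λ t → ∑[ b < n ] F b t) (Triangles G))
      ≡⟨ Σ-cong-All (All.map (triangle-degree x) Triangles-cliques) ⟩
    Σ (map (λ t → at t + at t) (Triangles G))
      ≡⟨ Σ-+ at at (Triangles G) ⟩
    Σ (map at (Triangles G)) + Σ (map at (Triangles G))
      ≡⟨ sym (cong₂ _+_ Δᵥ≡Σ Δᵥ≡Σ) ⟩
    Δᵥ G x + Δᵥ G x ∎
    where
    F : Fin n → Triangle G → ℕ
    F b t = ι (adj G x b) * ι (_∈ᵗ_ G x t ∧ _∈ᵗ_ G b t)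
    at : Triangle G → ℕ
    at t = ι (_∈ᵗ_ G x t)
    Δᵥ≡Σ : Δᵥ G x ≡ Σ (map at (Triangles G))
    Δᵥ≡Σ = length-filterᵇ (_∈ᵗ_ G x) (Triangles G)

  Δₑ-sym : ∀ a b → Δₑ G (a , b) ≡ Δₑ G (b , a)
  Δₑ-sym a b = trans (length-filterᵇ _ (Triangles G))
    (trans (Σ-cong (λ t → cong ι (∧-comm (_∈ᵗ_ G a t) (_∈ᵗ_ G b t))) (Triangles G))
           (sym (length-filterᵇ _ (Triangles G))))

  Σ-Δₑ-edges-at≡2Δᵥ : ∀ x → Σ (map (Δₑ G) (filterᵇ (_∈ᵉ_ G x) (E G))) ≡ Δᵥ G x + Δᵥ G x
  Σ-Δₑ-edges-at≡2Δᵥ x = trans (Σ-edges-at x (Δₑ G) Δₑ-sym) (∑-adj-Δₑ≡2Δᵥ x)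

  E-multiplicity : ∀ a b → Σ (map (λ ω → ι (_=ᵉ_ G (a , b) ω)) (E G)) ≡ ι (isEdge G a b)
  E-multiplicity a b = begin
    Σ (map (λ ω → ι (_=ᵉ_ G (a , b) ω)) (E G))
      ≡⟨ Σ-E _ ⟩
    ∑[ c < n ] ∑[ d < n ] (ι (isEdge G c d) * ι ((a =ᵇ c) ∧ (b =ᵇ d)))
      ≡⟨ ∑-cong (λ c → ∑-cong λ d → split c d) ⟩
    ∑[ c < n ] ∑[ d < n ] (ι (isEdge G c d) * ι (b =ᵇ d) * ι (a =ᵇ c))
      ≡⟨ ∑-cong (λ c → sym (*-distribʳ-sum (ι (a =ᵇ c)) (λ d → ι (isEdge G c d) * ι (b =ᵇ d)))) ⟩
    ∑[ c < n ] (∑[ d < n ] (ι (isEdge G c d) * ι (b =ᵇ d)) * ι (a =ᵇ c))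
      ≡⟨ ∑-δ a (λ c → ∑[ d < n ] (ι (isEdge G c d) * ι (b =ᵇ d))) ⟩
    ∑[ d < n ] (ι (isEdge G a d) * ι (b =ᵇ d))
      ≡⟨ ∑-δ b (λ d → ι (isEdge G a d)) ⟩
    ι (isEdge G a b) ∎
    where
    split : ∀ c d → ι (isEdge G c d) * ι ((a =ᵇ c) ∧ (b =ᵇ d)) ≡ ι (isEdge G c d) * ι (b =ᵇ d) * ι (a =ᵇ c)
    split c d = trans (cong (ι (isEdge G c d) *_) (ι-∧ (a =ᵇ c) (b =ᵇ d)))
                      (x∙yz≈xz∙y (ι (isEdge G c d)) (ι (a =ᵇ c)) (ι (b =ᵇ d)))

module RationalCasts where

  import Data.Integer as ℤ
  import Data.Integer.Properties as ℤ
  open import Data.Integer using (+_)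
  open import Data.Nat.Coprimality using (1-coprimeTo) renaming (sym to coprime-sym)
  open import Data.Rational using (mkℚ; _/_; _+_; 1ℚ)
  open import Data.Rational.Properties using (normalize-coprime)
  open NatIndicators using (ι) renaming (Σ to Σℕ)

  ℕ→ℚ≡mkℚ : ∀ k → ℕ→ℚ k ≡ mkℚ (+ k) 0 (coprime-sym (1-coprimeTo k))
  ℕ→ℚ≡mkℚ k = normalize-coprime (coprime-sym (1-coprimeTo k))

  ℕ→ℚ-+ : ∀ a b → ℕ→ℚ (a ℕ.+ b) ≡ ℕ→ℚ a + ℕ→ℚ b
  ℕ→ℚ-+ a b = sym (trans (cong₂ _+_ (ℕ→ℚ≡mkℚ a) (ℕ→ℚ≡mkℚ b))
                         (cong (_/ 1) (cong₂ ℤ._+_ (ℤ.*-identityʳ (+ a)) (ℤ.*-identityʳ (+ b)))))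

  ℕ→ℚ-Σ : ∀ (f : A → ℕ) xs → ℕ→ℚ (Σℕ (map f xs)) ≡ Σℚ (map (ℕ→ℚ ∘ f) xs)
  ℕ→ℚ-Σ f []       = refl
  ℕ→ℚ-Σ f (x ∷ xs) = trans (ℕ→ℚ-+ (f x) _) (cong (_+_ (ℕ→ℚ (f x))) (ℕ→ℚ-Σ f xs))

  Σℚ-1≡length : ∀ (xs : List A) → Σℚ (map (λ _ → 1ℚ) xs) ≡ ℕ→ℚ (length xs)
  Σℚ-1≡length []       = refl
  Σℚ-1≡length (x ∷ xs) = trans (cong (_+_ 1ℚ) (Σℚ-1≡length xs)) (sym (ℕ→ℚ-+ 1 (length xs)))

  𝟙≡ℕ→ℚ∘ι : ∀ b → 𝟙 b ≡ ℕ→ℚ (ι b)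
  𝟙≡ℕ→ℚ∘ι false = refl
  𝟙≡ℕ→ℚ∘ι true  = refl

module Estimator {n : ℕ} (G : Graph n) .{{m≥1 : NonZero (m G)}} where

  open import Algebra.Bundles using (module CommutativeRing)
  open import Data.Rational using (_+_; _*_; _-_; _÷_; 1ℚ; 1/_)
  open import Data.Rational.Properties
    using (+-*-commutativeRing; *-assoc; *-comm; *-identityˡ; *-identityʳ; *-inverseʳ)
  open import Data.Rational.Solver using (module +-*-Solver)
  open SemiringSums (CommutativeRing.commutativeSemiring +-*-commutativeRing)
    using (Σ-cong; Σ-cong-All; Σ-+; Σ-*ˡ; Σ-swap)
  open NatIndicators using (ι) renaming (Σ to Σℕ)
  open TriangleCounts G using (IsEdge; E-edges; E-multiplicity; length-∈ᴺ-edges≡Δᵥ; Σ-Δₑ-edges-at≡2Δᵥ)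
  open RationalCasts
  open Sampling G
  open ≡-Reasoning
  open +-*-Solver using (solve; _:+_; _:-_; _:*_; _:=_; con)

  edge-term : ℚ → Fin n → Edge G → ℚ
  edge-term q v ω = Σℚ (map (λ e → (q * ℕ→ℚ (Δₑ G e) * X e ω) ÷ p) (filterᵇ (_∈ᵉ_ G v) (E G)))

  node-term : Fin n → Edge G → ℚ
  node-term v ω = Σℚ (map (λ e → X e ω ÷ p) (filterᵇ (_∈ᴺ_ G v) (E G)))

  p*[y÷p]≡y : ∀ y → p * (y ÷ p) ≡ y
  p*[y÷p]≡y y = begin
    p * (y * 1/ p)  ≡⟨ sym (*-assoc p y (1/ p)) ⟩
    p * y * 1/ p    ≡⟨ cong (_* 1/ p) (*-comm p y) ⟩
    y * p * 1/ p    ≡⟨ *-assoc y p (1/ p) ⟩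
    y * (p * 1/ p)  ≡⟨ cong (y *_) (*-inverseʳ p) ⟩
    y * 1ℚ          ≡⟨ *-identityʳ y ⟩
    y               ∎

  sampled-once : ∀ {e} → IsEdge e → Σℚ (map (X e) (E G)) ≡ 1ℚ
  sampled-once {a , b} ab = begin
    Σℚ (map (X (a , b)) (E G))                  ≡⟨ Σ-cong (𝟙≡ℕ→ℚ∘ι ∘ _=ᵉ_ G (a , b)) (E G) ⟩
    Σℚ (map (ℕ→ℚ ∘ ι ∘ _=ᵉ_ G (a , b)) (E G))  ≡⟨ sym (ℕ→ℚ-Σ (ι ∘ _=ᵉ_ G (a , b)) (E G)) ⟩
    ℕ→ℚ (Σℕ (map (ι ∘ _=ᵉ_ G (a , b)) (E G)))  ≡⟨ cong ℕ→ℚ (E-multiplicity a b) ⟩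
    ℕ→ℚ (ι (isEdge G a b))                    ≡⟨ cong (ℕ→ℚ ∘ ι) (to T-≡ ab) ⟩
    1ℚ                                         ∎

  𝔼-inverse-probability-weighting : ∀ (g : Edge G → ℚ) {L} → All IsEdge L →
                                    𝔼 (λ ω → Σℚ (map (λ e → (g e * X e ω) ÷ p) L)) ≡ Σℚ (map g L)
  𝔼-inverse-probability-weighting g {L} L-edges = begin
    Σℚ (map (λ ω → p * Σℚ (map (λ e → (g e * X e ω) ÷ p) L)) (E G))
      ≡⟨ Σ-cong (λ ω → trans (sym (Σ-*ˡ p (λ e → (g e * X e ω) ÷ p) L))
                             (Σ-cong (λ e → p*[y÷p]≡y (g e * X e ω)) L)) (E G) ⟩
    Σℚ (map (λ ω → Σℚ (map (λ e → g e * X e ω) L)) (E G))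
      ≡⟨ Σ-swap (λ ω e → g e * X e ω) (E G) L ⟩
    Σℚ (map (λ e → Σℚ (map (λ ω → g e * X e ω) (E G))) L)
      ≡⟨ Σ-cong-All (All.map (λ {e} e-edge → trans (Σ-*ˡ (g e) (X e) (E G))
                       (trans (cong (g e *_) (sampled-once e-edge)) (*-identityʳ (g e)))) L-edges) ⟩
    Σℚ (map g L) ∎

  𝔼-+-* : ∀ (Y Z : Edge G → ℚ) c → 𝔼 (λ ω → Y ω + c * Z ω) ≡ 𝔼 Y + c * 𝔼 Z
  𝔼-+-* Y Z c = begin
    Σℚ (map (λ ω → p * (Y ω + c * Z ω)) (E G))      ≡⟨ Σ-cong (λ ω → distrib p (Y ω) c (Z ω)) (E G) ⟩
    Σℚ (map (λ ω → p * Y ω + c * (p * Z ω)) (E G))  ≡⟨ Σ-+ (λ ω → p * Y ω) (λ ω → c * (p * Z ω)) (E G) ⟩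
    𝔼 Y + Σℚ (map (λ ω → c * (p * Z ω)) (E G))      ≡⟨ cong (_+_ (𝔼 Y)) (Σ-*ˡ c (λ ω → p * Z ω) (E G)) ⟩
    𝔼 Y + c * 𝔼 Z                                    ∎
    where
    distrib : ∀ p y c z → p * (y + c * z) ≡ p * y + c * (p * z)
    distrib = solve 4 (λ p y c z → p :* (y :+ c :* z) := p :* y :+ c :* (p :* z)) refl

  𝔼-edge-term : ∀ q v → 𝔼 (edge-term q v) ≡ q * ℕ→ℚ (Δᵥ G v ℕ.+ Δᵥ G v)
  𝔼-edge-term q v = begin
    𝔼 (edge-term q v)
      ≡⟨ 𝔼-inverse-probability-weighting (λ e → q * ℕ→ℚ (Δₑ G e)) (filter⁺ (T? ∘ _∈ᵉ_ G v) E-edges) ⟩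
    Σℚ (map (λ e → q * ℕ→ℚ (Δₑ G e)) edges-at-v)
      ≡⟨ Σ-*ˡ q (ℕ→ℚ ∘ Δₑ G) edges-at-v ⟩
    q * Σℚ (map (ℕ→ℚ ∘ Δₑ G) edges-at-v)
      ≡⟨ cong (q *_) (sym (ℕ→ℚ-Σ (Δₑ G) edges-at-v)) ⟩
    q * ℕ→ℚ (Σℕ (map (Δₑ G) edges-at-v))
      ≡⟨ cong (λ k → q * ℕ→ℚ k) (Σ-Δₑ-edges-at≡2Δᵥ v) ⟩
    q * ℕ→ℚ (Δᵥ G v ℕ.+ Δᵥ G v) ∎
    where edges-at-v = filterᵇ (_∈ᵉ_ G v) (E G)

  𝔼-node-term : ∀ v → 𝔼 (node-term v) ≡ ℕ→ℚ (Δᵥ G v)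
  𝔼-node-term v = begin
    𝔼 (node-term v)
      ≡⟨ Σ-cong (λ ω → cong (p *_) (Σ-cong (λ e → cong (_÷ p) (sym (*-identityˡ (X e ω)))) edges-around-v)) (E G) ⟩
    𝔼 (λ ω → Σℚ (map (λ e → (1ℚ * X e ω) ÷ p) edges-around-v))
      ≡⟨ 𝔼-inverse-probability-weighting (λ _ → 1ℚ) (filter⁺ (T? ∘ _∈ᴺ_ G v) E-edges) ⟩
    Σℚ (map (λ _ → 1ℚ) edges-around-v)
      ≡⟨ Σℚ-1≡length edges-around-v ⟩
    ℕ→ℚ (length edges-around-v)
      ≡⟨ cong ℕ→ℚ (length-∈ᴺ-edges≡Δᵥ v) ⟩
    ℕ→ℚ (Δᵥ G v) ∎
    where edges-around-v = filterᵇ (_∈ᴺ_ G v) (E G)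

  -- The solver reads ℕ→ℚ 2 as the constant 1ℚ + 1ℚ; both evaluate to the same rational.
  2qk+[1-2q]k≡k : ∀ q k → q * ℕ→ℚ (k ℕ.+ k) + (1ℚ - ℕ→ℚ 2 * q) * ℕ→ℚ k ≡ ℕ→ℚ k
  2qk+[1-2q]k≡k q k = trans (cong (λ s → q * s + (1ℚ - ℕ→ℚ 2 * q) * ℕ→ℚ k) (ℕ→ℚ-+ k k))
    (solve 2 (λ q x → q :* (x :+ x) :+ (con 1ℚ :- (con 1ℚ :+ con 1ℚ) :* q) :* x := x) refl q (ℕ→ℚ k))

lemma3p2 : ∀ {n : ℕ} (G : Graph n) .{{m≥1 : NonZero (m G)}} (q : ℚ)
    → 0ℚ ≤ q → q ≤ ½ → (v : Fin n)
    → Sampling.𝔼 G (Sampling.Xq G q v) ≡ ℕ→ℚ (Δᵥ G v)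
lemma3p2 G q _ _ v = begin
  𝔼 (Xq q v)                                        ≡⟨ 𝔼-+-* (edge-term q v) (node-term v) c ⟩
  𝔼 (edge-term q v) + c * 𝔼 (node-term v)          ≡⟨ cong₂ (λ s t → s + c * t) (𝔼-edge-term q v) (𝔼-node-term v) ⟩
  q * ℕ→ℚ (Δᵥ G v ℕ.+ Δᵥ G v) + c * ℕ→ℚ (Δᵥ G v)  ≡⟨ 2qk+[1-2q]k≡k q (Δᵥ G v) ⟩
  ℕ→ℚ (Δᵥ G v)                                      ∎
  where
  open import Data.Rational using (_+_; _*_; _-_; 1ℚ)
  open Sampling G
  open Estimator G
  open ≡-Reasoning
  c = 1ℚ - ℕ→ℚ 2 * q
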